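{- Let $q\geq 2$ be an integer and let $A_q=\{q^n+n:n\in\mathbb{N}\}$. Then $(\mathbb{Z},+,A_q)$ is interdefinable with $(\mathbb{Z},+,<,q^x)$, where $q^x$ denotes the function $x\mapsto q^x$ with domain $\mathbb{N}$. In particular, $(\mathbb{Z},+,A_q)$ is unstable.
   Context: $(\mathbb{Z},+,A_q)$ is the expansion of $(\mathbb{Z},+)$ by a unary predicate for $A_q$. Two structures with the same universe are interdefinable if they have the same definable (with parameters) sets. $\mathbb{N}$ includes $0$. -}

module Defs where

open import Data.Nat using (ℕ; zero; suc; _^_) renaming (_+_ to _+ℕ_; _<_ to _<ℕ_)
open import Data.Integer using (ℤ; +_; _+_; _<_)
open import Data.Fin using (Fin)
open import Data.Vec using (Vec; []; _∷_; lookup; _++_)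
open import Data.Product using (Σ; _×_; _,_)
open import Data.Empty using (⊥)
open import Relation.Nullary using (¬_)
open import Relation.Binary.PropositionalEquality using (_≡_)
open import Function.Bundles using (_⇔_)

-- A first-order structure with universe ℤ, the function symbol + and
-- finitely/arbitrarily many relation symbols.  The function q^x (domain ℕ)
-- is represented by its graph, a binary relation.
record Structure : Set₁ where
  field
    Rel   : Set
    arity : Rel → ℕ
    interp : (R : Rel) → Vec ℤ (arity R) → Set
open Structure public

data Term (n : ℕ) : Set where
  var : Fin n → Term n
  par : ℤ → Term n
  _⊕_ : Term n → Term n → Term n

evalT : ∀ {n} → Vec ℤ n → Term n → ℤ
evalT ρ (var i) = lookup ρ i
evalT ρ (par c) = c
evalT ρ (s ⊕ t) = evalT ρ s + evalT ρ t

evalTs : ∀ {n k} → Vec ℤ n → Vec (Term n) k → Vec ℤ k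
evalTs ρ [] = []
evalTs ρ (t ∷ ts) = evalT ρ t ∷ evalTs ρ ts

-- First-order formulas (with parameters) in the language of M, n free variables.
-- Connectives ¬, ∧, ∃ form a complete set for classical logic.
data Formula (M : Structure) (n : ℕ) : Set where
  _≐_  : Term n → Term n → Formula M n
  rel  : (R : Rel M) → Vec (Term n) (arity M R) → Formula M n
  ~_   : Formula M n → Formula M n
  _∧_  : Formula M n → Formula M n → Formula M n
  ex   : Formula M (suc n) → Formula M n

-- Classical (double-negation / Gödel–Gentzen) semantics; variable 0 is the
-- most recently bound one.
⟦_⟧ : ∀ {M n} → Formula M n → Vec ℤ n → Set
⟦ s ≐ t ⟧ ρ = ¬ ¬ (evalT ρ s ≡ evalT ρ t)
⟦_⟧ {M} (rel R ts) ρ = ¬ ¬ interp M R (evalTs ρ ts)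
⟦ ~ φ ⟧ ρ = ¬ ⟦ φ ⟧ ρ
⟦ φ ∧ ψ ⟧ ρ = ⟦ φ ⟧ ρ × ⟦ ψ ⟧ ρ
⟦ ex φ ⟧ ρ = ¬ ¬ Σ ℤ (λ x → ⟦ φ ⟧ (x ∷ ρ))

Definable : (M : Structure) (n : ℕ) → (Vec ℤ n → Set) → Set
Definable M n S = Σ (Formula M n) (λ φ → ∀ ρ → S ρ ⇔ ⟦ φ ⟧ ρ)

Interdefinable : Structure → Structure → Set₁
Interdefinable M N = ∀ n (S : Vec ℤ n → Set) → Definable M n S ⇔ Definable N n S

Unstable : Structure → Set
Unstable M = Σ ℕ λ m → Σ ℕ λ k → Σ (Formula M (m +ℕ k)) λ φ →
  Σ (ℕ → Vec ℤ m) λ a → Σ (ℕ → Vec ℤ k) λ b →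
    ∀ i j → ⟦ φ ⟧ (a i ++ b j) ⇔ (i <ℕ j)

A : ℕ → ℤ → Set
A q x = Σ ℕ λ n → x ≡ + (q ^ n +ℕ n)

data RelA : Set where
  isA : RelA

ZA : ℕ → Structure
ZA q = record
  { Rel = RelA
  ; arity = λ _ → 1
  ; interp = λ { isA (x ∷ []) → A q x }
  }

data RelP : Set where
  less powq : RelP

ZP : ℕ → Structure
ZP q = record
  { Rel = RelP
  ; arity = λ _ → 2
  ; interp = λ { less (x ∷ y ∷ []) → x < y
               ; powq (x ∷ y ∷ []) → Σ ℕ λ n → (x ≡ + n) × (y ≡ + (q ^ n)) }
  }

-- Write q = 2 + r and a n = qⁿ + n, so that A_q = { a n }.  Because qⁿ grows fast, the
-- equation (q+1)·a m + 1 = a k + q·a n + q has, within A_q, only the solutions m = n+1,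
-- k = n+2; hence the successor map of A_q is definable in (ℤ,+,A_q).  As
-- q·a n + 1 − a (n+1) = (q−1)·n, it recovers the index n of a n, and with it ℕ, the order
-- (x < y iff y − x − 1 ∈ ℕ) and the graph of n ↦ qⁿ = a n − n.  Conversely A_q is
-- { qⁿ + n } in (ℤ,+,<,qˣ).  So each structure interprets the other, and translating
-- formulas along an interpretation transfers definable sets.  The definable order on ℕ
-- has the order property.

module Submission where

open import Defs
open import Level using (0ℓ)
open import Data.Nat as ℕ using (ℕ; zero; suc; _≤_; _^_; _<?_; z≤n; s≤s)
import Data.Nat.Properties as ℕP
open import Data.Nat.Tactic.RingSolver using (solve-∀)
open import Data.Integer as ℤ using (ℤ; +_; +[1+_]; +<+)
import Data.Integer.Properties as ℤP
open import Algebra.Properties.AbelianGroup ℤP.+-0-abelianGroup using (∙-cancelʳ; \\-leftDividesˡ)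
open import Data.Fin using (zero; suc)
open import Data.Vec using (Vec; []; _∷_; lookup; map)
open import Data.Product using (Σ; _×_; _,_; proj₁; proj₂)
open import Data.Product.Function.NonDependent.Propositional using (_×-⇔_)
import Data.Product.Function.Dependent.Propositional as Σ
open import Data.Empty using (⊥-elim)
open import Effect.Monad using (RawMonad)
open import Function.Base using (_∘_)
open import Function.Bundles using (_⇔_; mk⇔; Equivalence)
open import Function.Construct.Identity using (⇔-id)
open import Function.Construct.Composition using (_⇔-∘_)
open import Function.Construct.Symmetry using (⇔-sym)
open import Function.Related.TypeIsomorphisms using (¬-cong-⇔)
open import Relation.Nullary using (yes; no)
open import Relation.Nullary.Negation using (¬_; Stable; negated-stable; ¬¬-Monad; ¬¬-map)
open import Relation.Nullary.Decidable using (decidable-stable)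
open import Relation.Binary.Definitions using (tri<; tri≈; tri>)
open import Relation.Binary.PropositionalEquality
  using (_≡_; _≢_; refl; sym; trans; cong; cong₂; subst; module ≡-Reasoning)

open RawMonad (¬¬-Monad {0ℓ})
open Equivalence using (to; from)

private
  variable
    M N : Structure
    n k : ℕ

wkT : Term n → Term (suc n)
wkT (var i) = var (suc i)
wkT (par c) = par c
wkT (s ⊕ t) = wkT s ⊕ wkT t

substT : Vec (Term n) k → Term k → Term n
substT σ (var i) = lookup σ i
substT σ (par c) = par c
substT σ (s ⊕ t) = substT σ s ⊕ substT σ t

liftS : Vec (Term n) k → Vec (Term (suc n)) (suc k)
liftS σ = var zero ∷ map wkT σ

substF : Vec (Term n) k → Formula M k → Formula M n
substF σ (s ≐ t) = substT σ s ≐ substT σ t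
substF σ (rel R ts) = rel R (map (substT σ) ts)
substF σ (~ φ) = ~ substF σ φ
substF σ (φ ∧ ψ) = substF σ φ ∧ substF σ ψ
substF σ (ex φ) = ex (substF (liftS σ) φ)

infixr 25 _·_

_·_ : ℕ → Term n → Term n
zero · t = par (+ 0)
suc c · t = t ⊕ c · t

evalT-wkT : ∀ x (ρ : Vec ℤ n) t → evalT (x ∷ ρ) (wkT t) ≡ evalT ρ t
evalT-wkT x ρ (var i) = refl
evalT-wkT x ρ (par c) = refl
evalT-wkT x ρ (s ⊕ t) = cong₂ ℤ._+_ (evalT-wkT x ρ s) (evalT-wkT x ρ t)

evalTs-wkT : ∀ x (ρ : Vec ℤ n) (σ : Vec (Term n) k) → evalTs (x ∷ ρ) (map wkT σ) ≡ evalTs ρ σ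
evalTs-wkT x ρ [] = refl
evalTs-wkT x ρ (t ∷ σ) = cong₂ _∷_ (evalT-wkT x ρ t) (evalTs-wkT x ρ σ)

lookup-evalTs : ∀ (ρ : Vec ℤ n) (σ : Vec (Term n) k) i → lookup (evalTs ρ σ) i ≡ evalT ρ (lookup σ i)
lookup-evalTs ρ (t ∷ σ) zero = refl
lookup-evalTs ρ (t ∷ σ) (suc i) = lookup-evalTs ρ σ i

evalT-substT : ∀ (ρ : Vec ℤ n) (σ : Vec (Term n) k) t → evalT ρ (substT σ t) ≡ evalT (evalTs ρ σ) t
evalT-substT ρ σ (var i) = sym (lookup-evalTs ρ σ i)
evalT-substT ρ σ (par c) = refl
evalT-substT ρ σ (s ⊕ t) = cong₂ ℤ._+_ (evalT-substT ρ σ s) (evalT-substT ρ σ t)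

evalTs-substT : ∀ {j} (ρ : Vec ℤ n) (σ : Vec (Term n) k) (ts : Vec (Term k) j) →
                evalTs ρ (map (substT σ) ts) ≡ evalTs (evalTs ρ σ) ts
evalTs-substT ρ σ [] = refl
evalTs-substT ρ σ (t ∷ ts) = cong₂ _∷_ (evalT-substT ρ σ t) (evalTs-substT ρ σ ts)

evalT-· : ∀ (ρ : Vec ℤ n) c t → evalT ρ (c · t) ≡ + c ℤ.* evalT ρ t
evalT-· ρ zero t = refl
evalT-· ρ (suc c) t = trans (cong (ℤ._+_ (evalT ρ t)) (evalT-· ρ c t)) (sym (ℤP.suc-* (+ c) (evalT ρ t)))

evalT-·-+ : ∀ (ρ : Vec ℤ n) c t {x} → evalT ρ t ≡ + x → evalT ρ (c · t) ≡ + (c ℕ.* x)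
evalT-·-+ ρ c t {x} t≡x = trans (evalT-· ρ c t) (trans (cong (ℤ._*_ (+ c)) t≡x) (sym (ℤP.pos-* c x)))

⟦substF⟧ : ∀ (φ : Formula M k) (σ : Vec (Term n) k) ρ → ⟦ substF σ φ ⟧ ρ ⇔ ⟦ φ ⟧ (evalTs ρ σ)
⟦substF⟧ (s ≐ t) σ ρ rewrite evalT-substT ρ σ s | evalT-substT ρ σ t = ⇔-id _
⟦substF⟧ (rel R ts) σ ρ rewrite evalTs-substT ρ σ ts = ⇔-id _
⟦substF⟧ (~ φ) σ ρ = ¬-cong-⇔ (⟦substF⟧ φ σ ρ)
⟦substF⟧ (φ ∧ ψ) σ ρ = ⟦substF⟧ φ σ ρ ×-⇔ ⟦substF⟧ ψ σ ρ
⟦substF⟧ (ex φ) σ ρ = ¬-cong-⇔ (¬-cong-⇔ (Σ.congˡ λ {x} →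
  ⟦ φ ⟧-cong (cong (x ∷_) (evalTs-wkT x ρ σ)) ⇔-∘ ⟦substF⟧ φ (liftS σ) (x ∷ ρ)))
  where
  ⟦_⟧-cong : ∀ {m} (φ : Formula M m) {ρ ρ′} → ρ ≡ ρ′ → ⟦ φ ⟧ ρ ⇔ ⟦ φ ⟧ ρ′
  ⟦ φ ⟧-cong refl = ⇔-id _

⟦⟧-stable : ∀ (φ : Formula M n) ρ → Stable (⟦ φ ⟧ ρ)
⟦⟧-stable (s ≐ t) ρ = negated-stable
⟦⟧-stable (rel R ts) ρ = negated-stable
⟦⟧-stable (~ φ) ρ = negated-stable
⟦⟧-stable (φ ∧ ψ) ρ ¬¬φ∧ψ = ⟦⟧-stable φ ρ (¬¬-map proj₁ ¬¬φ∧ψ) , ⟦⟧-stable ψ ρ (¬¬-map proj₂ ¬¬φ∧ψ)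
⟦⟧-stable (ex φ) ρ = negated-stable

record Interpretation (M N : Structure) : Set where
  field
    define  : (R : Rel M) → Formula N (arity M R)
    defines : ∀ R v → ⟦ define R ⟧ v ⇔ (¬ ¬ interp M R v)
open Interpretation

translate : Interpretation M N → Formula M n → Formula N n
translate I (s ≐ t) = s ≐ t
translate I (rel R ts) = substF ts (define I R)
translate I (~ φ) = ~ translate I φ
translate I (φ ∧ ψ) = translate I φ ∧ translate I ψ
translate I (ex φ) = ex (translate I φ)

⟦translate⟧ : ∀ (I : Interpretation M N) (φ : Formula M n) ρ → ⟦ translate I φ ⟧ ρ ⇔ ⟦ φ ⟧ ρ
⟦translate⟧ I (s ≐ t) ρ = ⇔-id _
⟦translate⟧ I (rel R ts) ρ = defines I R (evalTs ρ ts) ⇔-∘ ⟦substF⟧ (define I R) ts ρ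
⟦translate⟧ I (~ φ) ρ = ¬-cong-⇔ (⟦translate⟧ I φ ρ)
⟦translate⟧ I (φ ∧ ψ) ρ = ⟦translate⟧ I φ ρ ×-⇔ ⟦translate⟧ I ψ ρ
⟦translate⟧ I (ex φ) ρ = ¬-cong-⇔ (¬-cong-⇔ (Σ.congˡ λ {x} → ⟦translate⟧ I φ (x ∷ ρ)))

interpretation⇒definable : Interpretation M N → ∀ n S → Definable M n S → Definable N n S
interpretation⇒definable I n S (φ , S⇔⟦φ⟧) =
  translate I φ , λ ρ → ⇔-sym (⟦translate⟧ I φ ρ) ⇔-∘ S⇔⟦φ⟧ ρ

interpretations⇒interdefinable : Interpretation M N → Interpretation N M → Interdefinable M N
interpretations⇒interdefinable I J n S =
  mk⇔ (interpretation⇒definable I n S) (interpretation⇒definable J n S)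

+-squeeze : ∀ {x x′ y y′} → x ≤ x′ → y ≤ y′ → x ℕ.+ y ≡ x′ ℕ.+ y′ → x ≡ x′ × y ≡ y′
+-squeeze {x} {x′} {y} {y′} x≤x′ y≤y′ eq = x≡x′ , ℕP.+-cancelˡ-≡ x y y′ (trans eq (cong (ℕ._+ y′) (sym x≡x′)))
  where
  x≡x′ : x ≡ x′
  x≡x′ = ℕP.≤-antisym x≤x′ (ℕP.+-cancelʳ-≤ y′ x′ x (subst (ℕ._≤ x ℕ.+ y′) eq (ℕP.+-monoʳ-≤ x y≤y′)))

<⇔+[1+n] : ∀ {i j} → i ℤ.< j ⇔ Σ ℕ λ n → i ℤ.+ +[1+ n ] ≡ j
<⇔+[1+n] {i} {j} = mk⇔ (λ i<j → difference (ℤ.- i ℤ.+ j) refl (0<-i+j i<j)) i<i+[1+n]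
  where
  0<-i+j : i ℤ.< j → ℤ.+0 ℤ.< ℤ.- i ℤ.+ j
  0<-i+j i<j = subst (ℤ._< ℤ.- i ℤ.+ j) (ℤP.+-inverseˡ i) (ℤP.+-monoʳ-< (ℤ.- i) i<j)
  difference : ∀ d → ℤ.- i ℤ.+ j ≡ d → ℤ.+0 ℤ.< d → Σ ℕ λ n → i ℤ.+ +[1+ n ] ≡ j
  difference ℤ.+0 _ (+<+ ())
  difference +[1+ n ] eq _ = n , trans (cong (ℤ._+_ i) (sym eq)) (\\-leftDividesˡ i j)
  i<i+[1+n] : (Σ ℕ λ n → i ℤ.+ +[1+ n ] ≡ j) → i ℤ.< j
  i<i+[1+n] (n , refl) = subst (ℤ._< i ℤ.+ +[1+ n ]) (ℤP.+-identityʳ i) (ℤP.+-monoʳ-< i (+<+ ℕ.z<s))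

+-≡⇔≡ : ∀ {s t x y} → s ≡ + x → t ≡ + y → (s ≡ t) ⇔ (x ≡ y)
+-≡⇔≡ refl refl = mk⇔ ℤP.+-injective (cong +_)

module Growth (r : ℕ) where
  open import Data.Nat
  open import Data.Nat.Properties

  q : ℕ
  q = 2 + r

  1<q : 1 < q
  1<q = s≤s (s≤s z≤n)

  a : ℕ → ℕ
  a n = q ^ n + n

  n<q^n : ∀ n → n < q ^ n
  n<q^n zero = s≤s z≤n
  n<q^n (suc n) = ≤-<-trans (n<q^n n) (^-monoʳ-< q 1<q (n<1+n n))

  q*n≤q^n : ∀ n → q * n ≤ q ^ n
  q*n≤q^n zero = ≤-trans (≤-reflexive (*-zeroʳ q)) z≤n
  q*n≤q^n (suc n) = *-monoʳ-≤ q (n<q^n n)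

  x+x≤q*x : ∀ x → x + x ≤ q * x
  x+x≤q*x x = +-monoʳ-≤ x (m≤m+n x (r * x))

  a-mono-< : ∀ {i j} → i < j → a i < a j
  a-mono-< i<j = +-mono-< (^-monoʳ-< q 1<q i<j) i<j

  a-mono-≤ : ∀ {i j} → i ≤ j → a i ≤ a j
  a-mono-≤ i≤j = +-mono-≤ (^-monoʳ-≤ q i≤j) i≤j

  a-injective : ∀ {i j} → a i ≡ a j → i ≡ j
  a-injective {i} {j} eq with <-cmp i j
  ... | tri< i<j _ _ = ⊥-elim (<⇒≢ (a-mono-< i<j) eq)
  ... | tri≈ _ i≡j _ = i≡j
  ... | tri> _ _ j<i = ⊥-elim (<⇒≢ (a-mono-< j<i) (sym eq))

  a-gap : ∀ k → a k + q ≤ a (suc k)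
  a-gap k = begin
    q ^ k + k + q               ≡⟨ solve-∀′ (q ^ k) k r ⟩
    q ^ k + suc r * 1 + suc k   ≤⟨ +-monoˡ-≤ (suc k) (+-monoʳ-≤ (q ^ k) (*-monoʳ-≤ (suc r) (m^n>0 q k))) ⟩
    a (suc k)                   ∎
    where
    open ≤-Reasoning
    solve-∀′ : ∀ P k r → P + k + (2 + r) ≡ P + suc r * 1 + suc k
    solve-∀′ = solve-∀

  a-growth : ∀ m → suc q * a m + 1 < a (2 + m)
  a-growth m = begin-strict
    suc q * (P + m) + 1           ≡⟨ rearrange q P m ⟩
    (q * P + P + q * m) + suc m   <⟨ +-monoʳ-< (q * P + P + q * m) (n<1+n (suc m)) ⟩
    (q * P + P + q * m) + (2 + m) ≤⟨ +-monoˡ-≤ (2 + m) dominated ⟩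
    a (2 + m)                     ∎
    where
    open ≤-Reasoning
    P = q ^ m
    rearrange : ∀ q P m → suc q * (P + m) + 1 ≡ (q * P + P + q * m) + suc m
    rearrange = solve-∀
    dominated : q * P + P + q * m ≤ q * (q * P)
    dominated = begin
      q * P + P + q * m ≤⟨ +-monoʳ-≤ (q * P + P) (q*n≤q^n m) ⟩
      q * P + P + P     ≡⟨ +-assoc (q * P) P P ⟩
      q * P + (P + P)   ≤⟨ +-monoʳ-≤ (q * P) (x+x≤q*x P) ⟩
      q * P + q * P     ≤⟨ x+x≤q*x (q * P) ⟩
      q * (q * P)       ∎

  index-identity : ∀ n → suc r * n + a (suc n) ≡ q * a n + 1
  index-identity n = identity r (q ^ n) n
    where
    identity : ∀ r P n → suc r * n + (suc (suc r) * P + suc n) ≡ suc (suc r) * (P + n) + 1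
    identity = solve-∀

  a-suc≤ : ∀ n → a (suc n) ≤ q * a n + 1
  a-suc≤ n = subst (a (suc n) ≤_) (index-identity n) (m≤n+m (a (suc n)) (suc r * n))

  succ-lhs : ℕ → ℕ
  succ-lhs m = suc q * a m + 1

  succ-rhs : ℕ → ℕ → ℕ
  succ-rhs n k = a k + (q * a n + q)

  succ-identity : ∀ n → succ-lhs (suc n) ≡ succ-rhs n (2 + n)
  succ-identity n = identity q (q ^ n) n
    where
    identity : ∀ q P n → suc q * (q * P + suc n) + 1 ≡ (q * (q * P) + suc (suc n)) + (q * (P + n) + q)
    identity = solve-∀

  m<n⇒succ-lhs<succ-rhs : ∀ {n m} k → m < n → succ-lhs m < succ-rhs n k
  m<n⇒succ-lhs<succ-rhs {n} {m} k m<n = begin-strict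
    succ-lhs m          <⟨ a-growth m ⟩
    a (2 + m)           ≤⟨ a-suc≤ (suc m) ⟩
    q * a (suc m) + 1   ≤⟨ +-mono-≤ (*-monoʳ-≤ q (a-mono-≤ m<n)) (<⇒≤ 1<q) ⟩
    q * a n + q         ≤⟨ m≤n+m (q * a n + q) (a k) ⟩
    succ-rhs n k        ∎
    where open ≤-Reasoning

  1+m<k⇒succ-lhs<succ-rhs : ∀ n {m k} → suc m < k → succ-lhs m < succ-rhs n k
  1+m<k⇒succ-lhs<succ-rhs n {m} {k} 1+m<k = begin-strict
    succ-lhs m          <⟨ a-growth m ⟩
    a (2 + m)           ≤⟨ a-mono-≤ 1+m<k ⟩
    a k                 ≤⟨ m≤m+n (a k) (q * a n + q) ⟩
    succ-rhs n k        ∎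
    where open ≤-Reasoning

  a+1≢a+q : ∀ m k → a m + 1 ≢ a k + q
  a+1≢a+q m k eq with <-cmp k m
  ... | tri< k<m _ _ = <⇒≢ (begin-strict
        a k + q   ≤⟨ a-gap k ⟩
        a (suc k) ≤⟨ a-mono-≤ k<m ⟩
        a m       <⟨ m<m+n (a m) z<s ⟩
        a m + 1   ∎) (sym eq)
    where open ≤-Reasoning
  ... | tri≈ _ refl _ = <⇒≢ (+-monoʳ-< (a m) 1<q) eq
  ... | tri> _ _ m<k = <⇒≢ (+-mono-≤-< (a-mono-≤ (<⇒≤ m<k)) 1<q) eq

  succ-lhs≢succ-rhs-diagonal : ∀ m k → succ-lhs m ≢ succ-rhs m k
  succ-lhs≢succ-rhs-diagonal m k eq = a+1≢a+q m k (+-cancelʳ-≡ (q * a m) (a m + 1) (a k + q) (begin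
    a m + 1 + q * a m   ≡⟨ solve-∀′ q (a m) ⟩
    succ-lhs m          ≡⟨ eq ⟩
    succ-rhs m k        ≡⟨ solve-∀″ q (a m) (a k) ⟩
    a k + q + q * a m   ∎))
    where
    open ≡-Reasoning
    solve-∀′ : ∀ q A → A + 1 + q * A ≡ suc q * A + 1
    solve-∀′ = solve-∀
    solve-∀″ : ∀ q A B → B + (q * A + q) ≡ B + q + q * A
    solve-∀″ = solve-∀

  succ-unique-below : ∀ {n m k} → n < m → k ≤ suc m → succ-lhs m ≡ succ-rhs n k → m ≡ suc n × k ≡ 2 + n
  succ-unique-below {n} {suc m} {k} (s≤s n≤m) k≤2+m eq
    with +-squeeze (a-mono-≤ k≤2+m) (+-monoˡ-≤ q (*-monoʳ-≤ q (a-mono-≤ n≤m)))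
                   (trans (sym eq) (succ-identity m))
  ... | ak≡a[2+m] , qan+q≡qam+q
    with a-injective {n} {m} (*-cancelˡ-≡ (a n) (a m) q (+-cancelʳ-≡ q _ _ qan+q≡qam+q))
  ... | refl = refl , a-injective ak≡a[2+m]

  succ-unique : ∀ {n m k} → succ-lhs m ≡ succ-rhs n k → m ≡ suc n × k ≡ 2 + n
  succ-unique {n} {m} {k} eq with <-cmp n m | suc m <? k
  ... | tri> _ _ m<n | _         = ⊥-elim (<⇒≢ (m<n⇒succ-lhs<succ-rhs k m<n) eq)
  ... | tri≈ _ refl _ | _        = ⊥-elim (succ-lhs≢succ-rhs-diagonal m k eq)
  ... | tri< _ _ _ | yes 1+m<k   = ⊥-elim (<⇒≢ (1+m<k⇒succ-lhs<succ-rhs n 1+m<k) eq)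
  ... | tri< n<m _ _ | no 1+m≮k  = succ-unique-below n<m (≮⇒≥ 1+m≮k) eq

module Formulas (r : ℕ) where
  open Growth r

  v0 : ∀ {n} → Term (suc n)
  v0 = var zero
  v1 : ∀ {n} → Term (suc (suc n))
  v1 = var (suc zero)
  v2 : ∀ {n} → Term (suc (suc (suc n)))
  v2 = var (suc (suc zero))

  𝔸 : ∀ {n} → Term n → Formula (ZA q) n
  𝔸 t = rel isA (t ∷ [])

  -- Succ(x, y) :≡ x ∈ A ∧ y ∈ A ∧ ∃ z ∈ A. (q+1)·y + 1 = z + q·x + q
  Succ : Formula (ZA q) 2
  Succ = 𝔸 v0 ∧ (𝔸 v1 ∧ ex (𝔸 v0 ∧ ((suc q · v2 ⊕ par (+ 1)) ≐ (v0 ⊕ (q · v1 ⊕ par (+ q))))))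

  succ-equation : ∀ x y z → let ρ = + z ∷ + x ∷ + y ∷ [] in
    (evalT ρ (suc q · v2 ⊕ par (+ 1)) ≡ evalT ρ (v0 ⊕ (q · v1 ⊕ par (+ q))))
      ⇔ (suc q ℕ.* y ℕ.+ 1 ≡ z ℕ.+ (q ℕ.* x ℕ.+ q))
  succ-equation x y z = +-≡⇔≡ (cong (ℤ._+ + 1) (evalT-·-+ ρ (suc q) v2 refl))
                              (cong (λ u → + z ℤ.+ (u ℤ.+ + q)) (evalT-·-+ ρ q v1 refl))
    where ρ = + z ∷ + x ∷ + y ∷ []

  Succ-defines : ∀ x y → ⟦ Succ ⟧ (x ∷ y ∷ []) ⇔ (¬ ¬ Σ ℕ λ n → x ≡ + a n × y ≡ + a (suc n))
  Succ-defines x y = mk⇔ successor successor⁻¹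
    where
    successor : ⟦ Succ ⟧ (x ∷ y ∷ []) → ¬ ¬ Σ ℕ λ n → x ≡ + a n × y ≡ + a (suc n)
    successor (x∈A , y∈A , ∃z) = do
      (n , refl) ← x∈A
      (m , refl) ← y∈A
      (z , z∈A , equation) ← ∃z
      (k , refl) ← z∈A
      e ← equation
      let (m≡1+n , _) = succ-unique {n} {m} {k} (to (succ-equation (a n) (a m) (a k)) e)
      pure (n , refl , cong (+_ ∘ a) m≡1+n)
    successor⁻¹ : (¬ ¬ Σ ℕ λ n → x ≡ + a n × y ≡ + a (suc n)) → ⟦ Succ ⟧ (x ∷ y ∷ [])
    successor⁻¹ h = ⟦⟧-stable Succ (x ∷ y ∷ []) do
      (n , refl , refl) ← h
      pure ( pure (n , refl) , pure (suc n , refl)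
           , pure (+ a (suc (suc n)) , pure (suc (suc n) , refl)
                  , pure (from (succ-equation (a n) (a (suc n)) (a (suc (suc n)))) (succ-identity n))))

  -- Index(x, t) :≡ ∃ y. Succ(x, y) ∧ (q−1)·t + y = q·x + 1
  Index : Formula (ZA q) 2
  Index = ex (substF (v1 ∷ v0 ∷ []) Succ ∧ ((suc r · v2 ⊕ v0) ≐ (q · v1 ⊕ par (+ 1))))

  index-equation : ∀ n t → let ρ = + a (suc n) ∷ + a n ∷ t ∷ [] in
    (evalT ρ (suc r · v2 ⊕ v0) ≡ evalT ρ (q · v1 ⊕ par (+ 1))) ⇔ (t ≡ + n)
  index-equation n t = mk⇔ (λ e → affine-injective (trans (sym lhs) (trans e rhs)))
                           (λ { refl → trans lhs (sym rhs) })
    where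
    ρ = + a (suc n) ∷ + a n ∷ t ∷ []
    affine : ℤ → ℤ
    affine u = + suc r ℤ.* u ℤ.+ + a (suc n)
    affine-injective : ∀ {u v} → affine u ≡ affine v → u ≡ v
    affine-injective {u} {v} = ℤP.*-cancelˡ-≡ (+ suc r) u v ∘ ∙-cancelʳ (+ a (suc n)) _ _
    lhs : evalT ρ (suc r · v2 ⊕ v0) ≡ affine t
    lhs = cong (ℤ._+ + a (suc n)) (evalT-· ρ (suc r) v2)
    rhs : evalT ρ (q · v1 ⊕ par (+ 1)) ≡ affine (+ n)
    rhs = trans (cong (ℤ._+ + 1) (evalT-·-+ ρ q v1 refl))
                (trans (cong +_ (sym (index-identity n)))
                       (cong (ℤ._+ + a (suc n)) (ℤP.pos-* (suc r) n)))

  Index-defines : ∀ x t → ⟦ Index ⟧ (x ∷ t ∷ []) ⇔ (¬ ¬ Σ ℕ λ n → x ≡ + a n × t ≡ + n)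
  Index-defines x t = mk⇔ index index⁻¹
    where
    index : ⟦ Index ⟧ (x ∷ t ∷ []) → ¬ ¬ Σ ℕ λ n → x ≡ + a n × t ≡ + n
    index h = do
      (y , succ , equation) ← h
      (n , refl , refl) ← to (Succ-defines x y) (to (⟦substF⟧ Succ (v1 ∷ v0 ∷ []) (y ∷ x ∷ t ∷ [])) succ)
      e ← equation
      pure (n , refl , to (index-equation n t) e)
    index⁻¹ : (¬ ¬ Σ ℕ λ n → x ≡ + a n × t ≡ + n) → ⟦ Index ⟧ (x ∷ t ∷ [])
    index⁻¹ h = do
      (n , refl , refl) ← h
      pure ( + a (suc n)
           , from (⟦substF⟧ Succ (v1 ∷ v0 ∷ []) (+ a (suc n) ∷ + a n ∷ + n ∷ []))
                  (from (Succ-defines (+ a n) (+ a (suc n))) (pure (n , refl , refl)))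
           , pure (from (index-equation n (+ n)) refl))

  IsNat : Formula (ZA q) 1
  IsNat = ex Index

  IsNat-defines : ∀ t → ⟦ IsNat ⟧ (t ∷ []) ⇔ (¬ ¬ Σ ℕ λ n → t ≡ + n)
  IsNat-defines t = mk⇔
    (λ h → do (x , index) ← h
              (n , _ , t≡n) ← to (Index-defines x t) index
              pure (n , t≡n))
    (λ h → do (n , refl) ← h
              pure (+ a n , from (Index-defines (+ a n) (+ n)) (pure (n , refl , refl))))

  Less : Formula (ZA q) 2
  Less = ex (substF (v0 ∷ []) IsNat ∧ ((v1 ⊕ (par (+ 1) ⊕ v0)) ≐ v2))

  Less-defines : ∀ x y → ⟦ Less ⟧ (x ∷ y ∷ []) ⇔ (¬ ¬ (x ℤ.< y))
  Less-defines x y = mk⇔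
    (λ h → do (w , nat , equation) ← h
              (n , refl) ← to (IsNat-defines w) (to (⟦substF⟧ IsNat (v0 ∷ []) (w ∷ x ∷ y ∷ [])) nat)
              e ← equation
              pure (from <⇔+[1+n] (n , e)))
    (λ h → do x<y ← h
              let (n , e) = to <⇔+[1+n] x<y
              pure ( + n
                   , from (⟦substF⟧ IsNat (v0 ∷ []) (+ n ∷ x ∷ y ∷ []))
                          (from (IsNat-defines (+ n)) (pure (n , refl)))
                   , pure e))

  Pow : Formula (ZA q) 2
  Pow = substF ((v1 ⊕ v0) ∷ v0 ∷ []) Index

  Pow-defines : ∀ x y → ⟦ Pow ⟧ (x ∷ y ∷ []) ⇔ (¬ ¬ Σ ℕ λ n → (x ≡ + n) × (y ≡ + (q ^ n)))
  Pow-defines x y = ¬-cong-⇔ (¬-cong-⇔ (mk⇔ power power⁻¹))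
                ⇔-∘ (Index-defines (y ℤ.+ x) x ⇔-∘ ⟦substF⟧ Index ((v1 ⊕ v0) ∷ v0 ∷ []) (x ∷ y ∷ []))
    where
    power : (Σ ℕ λ n → y ℤ.+ x ≡ + a n × x ≡ + n) → Σ ℕ λ n → (x ≡ + n) × (y ≡ + (q ^ n))
    power (n , y+n≡a[n] , refl) = n , refl , ∙-cancelʳ (+ n) y (+ (q ^ n)) y+n≡a[n]
    power⁻¹ : (Σ ℕ λ n → (x ≡ + n) × (y ≡ + (q ^ n))) → Σ ℕ λ n → y ℤ.+ x ≡ + a n × x ≡ + n
    power⁻¹ (n , refl , refl) = n , refl , refl

  A-in-ZP : Formula (ZP q) 1
  A-in-ZP = ex (ex (rel powq (v1 ∷ v0 ∷ []) ∧ (v2 ≐ (v0 ⊕ v1))))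

  A-in-ZP-defines : ∀ x → ⟦ A-in-ZP ⟧ (x ∷ []) ⇔ (¬ ¬ A q x)
  A-in-ZP-defines x = mk⇔
    (λ h → do (_ , h′) ← h
              (_ , pow , equation) ← h′
              (n , refl , refl) ← pow
              e ← equation
              pure (n , e))
    (λ h → do (n , refl) ← h
              pure (+ n , pure (+ (q ^ n) , pure (n , refl , refl) , pure refl)))

  ZA-in-ZP : Interpretation (ZA q) (ZP q)
  ZA-in-ZP = record
    { define  = λ { isA → A-in-ZP }
    ; defines = λ { isA (x ∷ []) → A-in-ZP-defines x }
    }

  ZP-in-ZA : Interpretation (ZP q) (ZA q)
  ZP-in-ZA = record
    { define  = λ { less → Less ; powq → Pow }
    ; defines = λ { less (x ∷ y ∷ []) → Less-defines x y ; powq (x ∷ y ∷ []) → Pow-defines x y }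
    }

  Less-orders-ℕ : ∀ i j → ⟦ Less ⟧ (+ i ∷ + j ∷ []) ⇔ (i ℕ.< j)
  Less-orders-ℕ i j = mk⇔
    (λ h → decidable-stable (i <? j) (¬¬-map ℤP.drop‿+<+ (to (Less-defines (+ i) (+ j)) h)))
    (λ i<j → from (Less-defines (+ i) (+ j)) (pure (+<+ i<j)))

  ZA-unstable : Unstable (ZA q)
  ZA-unstable = 1 , 1 , Less , (λ i → + i ∷ []) , (λ j → + j ∷ []) , Less-orders-ℕ

theorem4p8 : (q : ℕ) → 2 ≤ q → Interdefinable (ZA q) (ZP q) × Unstable (ZA q)
theorem4p8 (suc (suc r)) (s≤s (s≤s z≤n)) = interpretations⇒interdefinable ZA-in-ZP ZP-in-ZA , ZA-unstable
  where open Formulas r
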